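{- For $k \in \mathbb{Z}$ and $n \geq 1$, \begin{equation*} C_{n}^{(k)}=\frac{1}{n}\sum_{l=0}^{n}(-1)^{n-l}(n-l)!\binom{n}{l}\left(T_{l}^{(1,k-1)}-T_{l}^{(1,k)}\right). \end{equation*}
   Context: For $k\in\mathbb{Z}$, $Lif_k(t)=\sum_{m=0}^{\infty}\frac{t^m}{m!(m+1)^k}$. The poly-Cauchy numbers $C_n^{(k)}$ are defined by $Lif_k(\log(1+t))=\sum_{n\ge0}C_n^{(k)}\frac{t^n}{n!}$. For integers $r\ge0$ and $k$, the numbers $T_n^{(r,k)}$ are defined by $\left(\frac{t}{\log(1+t)}\right)^r Lif_k(\log(1+t))=\sum_{n\ge0}T_n^{(r,k)}\frac{t^n}{n!}$. -}

module Defs where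

open import Data.Nat as ℕ using (ℕ; zero; suc; _∸_; _!)
open import Data.Nat.Combinatorics using (_C_)
open import Data.Nat.Properties using (_!≢0)
open import Data.Integer as ℤ using (ℤ; +_; -[1+_])
open import Data.Rational using (ℚ; 0ℚ; 1ℚ; _+_; _*_; -_; _/_)

ℕ→ℚ : ℕ → ℚ
ℕ→ℚ n = (+ n) / 1

_^ℚ_ : ℚ → ℕ → ℚ
x ^ℚ zero = 1ℚ
x ^ℚ suc n = x * (x ^ℚ n)

sgn : ℕ → ℚ
sgn n = (- 1ℚ) ^ℚ n

sumTo : ℕ → (ℕ → ℚ) → ℚ
sumTo zero f = f 0
sumTo (suc n) f = sumTo n f + f (suc n)

-- Formal power series over ℚ: coefficient sequences (f n = [t^n] f)
FPS : Set
FPS = ℕ → ℚ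

oneS : FPS
oneS zero = 1ℚ
oneS (suc _) = 0ℚ

_⊛_ : FPS → FPS → FPS
(f ⊛ g) n = sumTo n (λ i → f i * g (n ∸ i))

_^S_ : FPS → ℕ → FPS
f ^S zero = oneS
f ^S suc m = f ⊛ (f ^S m)

-- composition f(g(t)), meaningful when g has zero constant term
-- (then [t^n] g^m = 0 for m > n, so the sum is finite)
_∘S_ : FPS → FPS → FPS
(f ∘S g) n = sumTo n (λ m → f m * (g ^S m) n)

-- log(1+t) = Σ_{n≥1} (-1)^{n+1} t^n / n
logS : FPS
logS zero = 0ℚ
logS (suc n) = sgn n * ((+ 1) / suc n)

-- 1/(m+1)^k for k ∈ ℤ
invPowZ : ℕ → ℤ → ℚ
invPowZ m (+ j) = ((+ 1) / suc m) ^ℚ j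
invPowZ m -[1+ j ] = ℕ→ℚ (suc m) ^ℚ suc j

invFact : ℕ → ℚ
invFact m = ((+ 1) / (m !)) {{m !≢0}}

-- Lif_k(t) = Σ_m t^m / (m! (m+1)^k)
Lif : ℤ → FPS
Lif k m = invFact m * invPowZ m k

-- log(1+t)/t - 1 = Σ_{n≥1} (-1)^n t^n/(n+1); its constant term is 0
logOverTMinusOne : FPS
logOverTMinusOne zero = 0ℚ
logOverTMinusOne (suc n) = sgn (suc n) * ((+ 1) / suc (suc n))

-- t/log(1+t) = 1/(1 + u) = Σ_m (-u)^m  with u = log(1+t)/t - 1
tOverLog : FPS
tOverLog = (λ m → sgn m) ∘S logOverTMinusOne

-- poly-Cauchy numbers: Lif_k(log(1+t)) = Σ C_n^(k) t^n/n!
polyC : ℕ → ℤ → ℚ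
polyC n k = ℕ→ℚ (n !) * (Lif k ∘S logS) n

-- T_n^(r,k): (t/log(1+t))^r Lif_k(log(1+t)) = Σ T_n^(r,k) t^n/n!
T : ℕ → ℕ → ℤ → ℚ
T n r k = ℕ→ℚ (n !) * ((tOverLog ^S r) ⊛ (Lif k ∘S logS)) n

module Submission where

-- Write L = log(1+t), c = Lif_k and G = c ∘ L, so that C_n^(k) = n! [t^n] G.
-- Since Lif_{k-1}(x) - Lif_k(x) = x Lif_k'(x) and t/L · L = t, the series
-- behind the T-numbers satisfy
--   (t/L) (Lif_{k-1}(L) - Lif_k(L)) = t · Lif_k'(L) =: E.
-- By the chain rule and L' = 1/(1+t) we get E/(1+t) = t · G', so for n ≥ 1
--   Σ_l (-1)^(n-l) [t^l] E = [t^n] (E/(1+t)) = n [t^n] G.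
-- Multiplying by n! = (n-l)! C(n,l) l! gives the theorem.

open import Defs
open import Data.Nat as ℕ using (ℕ; zero; suc; NonZero; _∸_; _!; z≤n; s≤s)
  renaming (_+_ to _+ℕ_; _*_ to _*ℕ_; _≤_ to _≤ℕ_; _<_ to _<ℕ_)
import Data.Nat.Properties as ℕP
open import Data.Nat.Properties using (_!*_!≢0)
open import Data.Nat.Combinatorics using (_C_; nCk≡n!/k![n-k]!; k![n∸k]!∣n!)
open import Data.Nat.DivMod using (m*[n/m]≡n)
open import Data.Integer as ℤ using (ℤ; +_; -[1+_]) renaming (_-_ to _-ℤ_)
import Data.Integer.Properties as ℤP
open import Data.Rational using (ℚ; 0ℚ; 1ℚ; _+_; _*_; -_; _-_; _/_; toℚᵘ)
open import Data.Rational.Properties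
import Data.Rational.Unnormalised as ℚᵘ
import Data.Rational.Unnormalised.Properties as ℚᵘP
open import Data.Rational.Solver using (module +-*-Solver)
open +-*-Solver
open import Relation.Binary.PropositionalEquality
open ≡-Reasoning

-- The embedding ℕ → ℚ is a semiring homomorphism; we check this through
-- unnormalised fractions, where n/1 needs no reduction.

toℚᵘ-ℕ→ℚ : ∀ n → toℚᵘ (ℕ→ℚ n) ℚᵘ.≃ ℚᵘ.mkℚᵘ (+ n) 0
toℚᵘ-ℕ→ℚ n = toℚᵘ-fromℚᵘ (ℚᵘ.mkℚᵘ (+ n) 0)

ℕ→ℚ-suc : ∀ n → ℕ→ℚ (suc n) ≡ 1ℚ + ℕ→ℚ n
ℕ→ℚ-suc n = toℚᵘ-injective
  (ℚᵘP.≃-trans (toℚᵘ-ℕ→ℚ (suc n))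
  (ℚᵘP.≃-trans (ℚᵘP.≃-reflexive sum-of-fractions)
  (ℚᵘP.≃-sym (ℚᵘP.≃-trans (toℚᵘ-homo-+ 1ℚ (ℕ→ℚ n))
                          (ℚᵘP.+-congʳ (toℚᵘ 1ℚ) (toℚᵘ-ℕ→ℚ n))))))
  where
  sum-of-fractions : ℚᵘ.mkℚᵘ (+ suc n) 0 ≡ ℚᵘ.mkℚᵘ (+ 1) 0 ℚᵘ.+ ℚᵘ.mkℚᵘ (+ n) 0
  sum-of-fractions = cong (λ z → ℚᵘ.mkℚᵘ (+ 1 ℤ.+ z) 0) (sym (ℤP.*-identityʳ (+ n)))

ℕ→ℚ-inverse : ∀ m → ℕ→ℚ (suc m) * ((+ 1) / suc m) ≡ 1ℚ
ℕ→ℚ-inverse m = toℚᵘ-injective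
  (ℚᵘP.≃-trans (toℚᵘ-homo-* (ℕ→ℚ (suc m)) ((+ 1) / suc m))
  (ℚᵘP.≃-trans (ℚᵘP.*-cong (toℚᵘ-ℕ→ℚ (suc m)) (toℚᵘ-fromℚᵘ (ℚᵘ.mkℚᵘ (+ 1) m)))
               (ℚᵘP.*-inverseʳ (ℚᵘ.mkℚᵘ (+ suc m) 0))))

ℕ→ℚ-+ : ∀ m n → ℕ→ℚ (m +ℕ n) ≡ ℕ→ℚ m + ℕ→ℚ n
ℕ→ℚ-+ zero n = sym (+-identityˡ (ℕ→ℚ n))
ℕ→ℚ-+ (suc m) n = begin
  ℕ→ℚ (suc (m +ℕ n))     ≡⟨ ℕ→ℚ-suc (m +ℕ n) ⟩
  1ℚ + ℕ→ℚ (m +ℕ n)      ≡⟨ cong (λ x → 1ℚ + x) (ℕ→ℚ-+ m n) ⟩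
  1ℚ + (ℕ→ℚ m + ℕ→ℚ n)   ≡⟨ sym (+-assoc 1ℚ (ℕ→ℚ m) (ℕ→ℚ n)) ⟩
  (1ℚ + ℕ→ℚ m) + ℕ→ℚ n   ≡⟨ cong (_+ ℕ→ℚ n) (sym (ℕ→ℚ-suc m)) ⟩
  ℕ→ℚ (suc m) + ℕ→ℚ n    ∎

ℕ→ℚ-* : ∀ m n → ℕ→ℚ (m *ℕ n) ≡ ℕ→ℚ m * ℕ→ℚ n
ℕ→ℚ-* zero n = sym (*-zeroˡ (ℕ→ℚ n))
ℕ→ℚ-* (suc m) n = begin
  ℕ→ℚ (n +ℕ m *ℕ n)          ≡⟨ ℕ→ℚ-+ n (m *ℕ n) ⟩
  ℕ→ℚ n + ℕ→ℚ (m *ℕ n)       ≡⟨ cong (λ x → ℕ→ℚ n + x) (ℕ→ℚ-* m n) ⟩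
  ℕ→ℚ n + ℕ→ℚ m * ℕ→ℚ n      ≡⟨ solve 2 (λ a b → a :+ b :* a := (con 1ℚ :+ b) :* a) refl (ℕ→ℚ n) (ℕ→ℚ m) ⟩
  (1ℚ + ℕ→ℚ m) * ℕ→ℚ n       ≡⟨ cong (_* ℕ→ℚ n) (sym (ℕ→ℚ-suc m)) ⟩
  ℕ→ℚ (suc m) * ℕ→ℚ n        ∎

sum-cong : ∀ n {f g : ℕ → ℚ} → (∀ i → i ≤ℕ n → f i ≡ g i) → sumTo n f ≡ sumTo n g
sum-cong zero eq = eq 0 z≤n
sum-cong (suc n) eq =
  cong₂ _+_ (sum-cong n (λ i i≤n → eq i (ℕP.m≤n⇒m≤1+n i≤n))) (eq (suc n) ℕP.≤-refl)

sum-ext : ∀ n {f g : ℕ → ℚ} → (∀ i → f i ≡ g i) → sumTo n f ≡ sumTo n g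
sum-ext n eq = sum-cong n (λ i _ → eq i)

sum-zero : ∀ n (f : ℕ → ℚ) → (∀ i → i ≤ℕ n → f i ≡ 0ℚ) → sumTo n f ≡ 0ℚ
sum-zero n f eq = trans (sum-cong n eq) (zeros n)
  where
  zeros : ∀ n → sumTo n (λ _ → 0ℚ) ≡ 0ℚ
  zeros zero = refl
  zeros (suc n) = trans (cong (_+ 0ℚ) (zeros n)) (+-identityʳ 0ℚ)

sum-+ : ∀ n (f g : ℕ → ℚ) → sumTo n (λ i → f i + g i) ≡ sumTo n f + sumTo n g
sum-+ zero f g = refl
sum-+ (suc n) f g = begin
  sumTo n (λ i → f i + g i) + (f (suc n) + g (suc n))
    ≡⟨ cong (_+ (f (suc n) + g (suc n))) (sum-+ n f g) ⟩
  (sumTo n f + sumTo n g) + (f (suc n) + g (suc n))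
    ≡⟨ solve 4 (λ a b c d → (a :+ b) :+ (c :+ d) := (a :+ c) :+ (b :+ d)) refl
         (sumTo n f) (sumTo n g) (f (suc n)) (g (suc n)) ⟩
  (sumTo n f + f (suc n)) + (sumTo n g + g (suc n)) ∎

sum-- : ∀ n (f g : ℕ → ℚ) → sumTo n (λ i → f i - g i) ≡ sumTo n f - sumTo n g
sum-- zero f g = refl
sum-- (suc n) f g = begin
  sumTo n (λ i → f i - g i) + (f (suc n) - g (suc n))
    ≡⟨ cong (_+ (f (suc n) - g (suc n))) (sum-- n f g) ⟩
  (sumTo n f - sumTo n g) + (f (suc n) - g (suc n))
    ≡⟨ solve 4 (λ a b c d → (a :- b) :+ (c :- d) := (a :+ c) :- (b :+ d)) refl
         (sumTo n f) (sumTo n g) (f (suc n)) (g (suc n)) ⟩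
  (sumTo n f + f (suc n)) - (sumTo n g + g (suc n)) ∎

sum-*l : ∀ n c (f : ℕ → ℚ) → c * sumTo n f ≡ sumTo n (λ i → c * f i)
sum-*l zero c f = refl
sum-*l (suc n) c f = trans (*-distribˡ-+ c _ _) (cong (_+ c * f (suc n)) (sum-*l n c f))

sum-*r : ∀ n c (f : ℕ → ℚ) → sumTo n f * c ≡ sumTo n (λ i → f i * c)
sum-*r n c f = trans (*-comm _ c) (trans (sum-*l n c f) (sum-ext n (λ i → *-comm c (f i))))

sum-shift : ∀ n (f : ℕ → ℚ) → sumTo (suc n) f ≡ f 0 + sumTo n (λ i → f (suc i))
sum-shift zero f = refl
sum-shift (suc n) f = trans (cong (_+ f (suc (suc n))) (sum-shift n f))
  (+-assoc (f 0) (sumTo n (λ i → f (suc i))) (f (suc (suc n))))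

sum-drop-last : ∀ n (f : ℕ → ℚ) → f (suc n) ≡ 0ℚ → sumTo (suc n) f ≡ sumTo n f
sum-drop-last n f last≡0 = trans (cong (λ x → sumTo n f + x) last≡0) (+-identityʳ (sumTo n f))

sum-drop-prefix : ∀ m d (f : ℕ → ℚ) → (∀ i → i <ℕ m → f i ≡ 0ℚ) →
                  sumTo (m +ℕ d) f ≡ sumTo d (λ j → f (m +ℕ j))
sum-drop-prefix zero d f _ = refl
sum-drop-prefix (suc m) d f prefix≡0 = begin
  sumTo (suc (m +ℕ d)) f
    ≡⟨ sum-shift (m +ℕ d) f ⟩
  f 0 + sumTo (m +ℕ d) (λ i → f (suc i))
    ≡⟨ cong₂ _+_ (prefix≡0 0 (s≤s z≤n))
         (sum-drop-prefix m d (λ i → f (suc i)) (λ i i<m → prefix≡0 (suc i) (s≤s i<m))) ⟩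
  0ℚ + sumTo d (λ j → f (suc (m +ℕ j)))
    ≡⟨ +-identityˡ _ ⟩
  sumTo d (λ j → f (suc m +ℕ j)) ∎

sum-reverse : ∀ n (f : ℕ → ℚ) → sumTo n f ≡ sumTo n (λ i → f (n ∸ i))
sum-reverse zero f = refl
sum-reverse (suc n) f = begin
  sumTo (suc n) f
    ≡⟨ sum-shift n f ⟩
  f 0 + sumTo n (λ i → f (suc i))
    ≡⟨ cong (λ x → f 0 + x) (sum-reverse n (λ i → f (suc i))) ⟩
  f 0 + sumTo n (λ i → f (suc (n ∸ i)))
    ≡⟨ +-comm (f 0) _ ⟩
  sumTo n (λ i → f (suc (n ∸ i))) + f 0
    ≡⟨ cong₂ _+_ (sum-cong n (λ i i≤n → cong f (sym (ℕP.+-∸-assoc 1 i≤n))))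
                 (cong f (sym (ℕP.n∸n≡0 n))) ⟩
  sumTo (suc n) (λ i → f (suc n ∸ i)) ∎

sum-triangle : ∀ n (F : ℕ → ℕ → ℚ) →
  sumTo n (λ s → sumTo s (λ m → F m s)) ≡ sumTo n (λ m → sumTo (n ∸ m) (λ j → F m (m +ℕ j)))
sum-triangle zero F = refl
sum-triangle (suc n) F = begin
  sumTo n (λ s → sumTo s (λ m → F m s)) + sumTo (suc n) (λ m → F m (suc n))
    ≡⟨ cong (_+ sumTo (suc n) (λ m → F m (suc n))) (sum-triangle n F) ⟩
  rows n + (sumTo n (λ m → F m (suc n)) + F (suc n) (suc n))
    ≡⟨ sym (+-assoc (rows n) _ _) ⟩
  (rows n + sumTo n (λ m → F m (suc n))) + F (suc n) (suc n)
    ≡⟨ cong₂ _+_ (sym (sum-+ n _ _)) (cong (F (suc n)) (sym (ℕP.+-identityʳ (suc n)))) ⟩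
  sumTo n (λ m → row n m + F m (suc n)) + F (suc n) (suc n +ℕ 0)
    ≡⟨ cong₂ _+_ (sum-cong n extend-row)
                 (cong (λ r → sumTo r (λ j → F (suc n) (suc n +ℕ j))) (sym (ℕP.n∸n≡0 n))) ⟩
  rows (suc n) ∎
  where
  row : ℕ → ℕ → ℚ
  row n m = sumTo (n ∸ m) (λ j → F m (m +ℕ j))
  rows : ℕ → ℚ
  rows n = sumTo n (row n)
  extend-row : ∀ m → m ≤ℕ n → row n m + F m (suc n) ≡ row (suc n) m
  extend-row m m≤n = begin
    row n m + F m (suc n)
      ≡⟨ cong (λ s → row n m + F m s)
           (sym (trans (ℕP.+-suc m (n ∸ m)) (cong suc (ℕP.m+[n∸m]≡n m≤n)))) ⟩
    sumTo (suc (n ∸ m)) (λ j → F m (m +ℕ j))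
      ≡⟨ cong (λ r → sumTo r (λ j → F m (m +ℕ j))) (sym (ℕP.+-∸-assoc 1 m≤n)) ⟩
    row (suc n) m ∎

-- Besides the Cauchy product ⊛ of Defs we use
-- multiplication by t and linear combinations Σ_m f_m P_m of a family of
-- series P whose m-th member has order at least m (such as the powers of a
-- series without constant term); truncating at n computes coefficient n.

timesT : FPS → FPS
timesT f zero = 0ℚ
timesT f (suc n) = f n

timesT-cong : ∀ {f g} → (∀ i → f i ≡ g i) → ∀ n → timesT f n ≡ timesT g n
timesT-cong eq zero = refl
timesT-cong eq (suc n) = eq n

lincomb : (ℕ → ℚ) → (ℕ → FPS) → FPS
lincomb f P n = sumTo n (λ m → f m * P m n)

HighOrder : (ℕ → FPS) → Set
HighOrder P = ∀ m i → i <ℕ m → P m i ≡ 0ℚ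

conv-congˡ : ∀ {f f'} g n → (∀ i → f i ≡ f' i) → (f ⊛ g) n ≡ (f' ⊛ g) n
conv-congˡ g n eq = sum-ext n (λ i → cong (_* g (n ∸ i)) (eq i))

conv-congʳ : ∀ f {g g'} n → (∀ i → g i ≡ g' i) → (f ⊛ g) n ≡ (f ⊛ g') n
conv-congʳ f n eq = sum-ext n (λ i → cong (f i *_) (eq (n ∸ i)))

conv-comm : ∀ f g n → (f ⊛ g) n ≡ (g ⊛ f) n
conv-comm f g n = trans (sum-reverse n (λ i → f i * g (n ∸ i)))
  (sum-cong n (λ i i≤n → trans (cong (λ j → f (n ∸ i) * g j) (ℕP.m∸[m∸n]≡n i≤n))
                              (*-comm (f (n ∸ i)) (g i))))

oneS-conv : ∀ f n → (oneS ⊛ f) n ≡ f n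
oneS-conv f zero = *-identityˡ (f 0)
oneS-conv f (suc n) = begin
  (oneS ⊛ f) (suc n)
    ≡⟨ sum-shift n (λ i → oneS i * f (suc n ∸ i)) ⟩
  1ℚ * f (suc n) + sumTo n (λ i → 0ℚ * f (n ∸ i))
    ≡⟨ cong₂ _+_ (*-identityˡ (f (suc n))) (sum-zero n _ (λ i _ → *-zeroˡ (f (n ∸ i)))) ⟩
  f (suc n) + 0ℚ
    ≡⟨ +-identityʳ (f (suc n)) ⟩
  f (suc n) ∎

conv-oneS : ∀ f n → (f ⊛ oneS) n ≡ f n
conv-oneS f n = trans (conv-comm f oneS n) (oneS-conv f n)

conv-scalʳ : ∀ f c g n → (f ⊛ (λ i → c * g i)) n ≡ c * (f ⊛ g) n
conv-scalʳ f c g n = trans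
  (sum-ext n (λ i → solve 3 (λ a b d → a :* (b :* d) := b :* (a :* d)) refl (f i) c (g (n ∸ i))))
  (sym (sum-*l n c _))

conv-subʳ : ∀ f g h n → (f ⊛ g) n - (f ⊛ h) n ≡ (f ⊛ (λ i → g i - h i)) n
conv-subʳ f g h n = trans (sym (sum-- n _ _))
  (sum-ext n (λ i → solve 3 (λ a b c → a :* b :- a :* c := a :* (b :- c)) refl
                      (f i) (g (n ∸ i)) (h (n ∸ i))))

conv-timesT : ∀ f g n → (timesT f ⊛ g) n ≡ timesT (f ⊛ g) n
conv-timesT f g zero = *-zeroˡ (g 0)
conv-timesT f g (suc n) = trans (sum-shift n (λ i → timesT f i * g (suc n ∸ i)))
  (trans (cong (_+ (f ⊛ g) n) (*-zeroˡ (g (suc n)))) (+-identityˡ _))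

timesT-one-conv : ∀ h n → (timesT oneS ⊛ h) n ≡ timesT h n
timesT-one-conv h n = trans (conv-timesT oneS h n) (timesT-cong (oneS-conv h) n)

-- (Σ_m f_m P_m) · g = Σ_m f_m (P_m · g): the order condition lets each
-- inner product start at index m.
lincomb-conv : ∀ {P} → HighOrder P → ∀ f g n → (lincomb f P ⊛ g) n ≡ lincomb f (λ m → P m ⊛ g) n
lincomb-conv {P} high f g n = begin
  sumTo n (λ s → sumTo s (λ m → f m * P m s) * g (n ∸ s))
    ≡⟨ sum-ext n (λ s → sum-*r s (g (n ∸ s)) (λ m → f m * P m s)) ⟩
  sumTo n (λ s → sumTo s (λ m → f m * P m s * g (n ∸ s)))
    ≡⟨ sum-triangle n (λ m s → f m * P m s * g (n ∸ s)) ⟩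
  sumTo n (λ m → sumTo (n ∸ m) (λ j → f m * P m (m +ℕ j) * g (n ∸ (m +ℕ j))))
    ≡⟨ sum-cong n column ⟩
  lincomb f (λ m → P m ⊛ g) n ∎
  where
  column : ∀ m → m ≤ℕ n →
    sumTo (n ∸ m) (λ j → f m * P m (m +ℕ j) * g (n ∸ (m +ℕ j))) ≡ f m * (P m ⊛ g) n
  column m m≤n = begin
    sumTo (n ∸ m) (λ j → f m * P m (m +ℕ j) * g (n ∸ (m +ℕ j)))
      ≡⟨ sum-ext (n ∸ m) (λ j → *-assoc (f m) _ _) ⟩
    sumTo (n ∸ m) (λ j → f m * (P m (m +ℕ j) * g (n ∸ (m +ℕ j))))
      ≡⟨ sym (sum-*l (n ∸ m) (f m) _) ⟩
    f m * sumTo (n ∸ m) (λ j → P m (m +ℕ j) * g (n ∸ (m +ℕ j)))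
      ≡⟨ cong (f m *_) (sym (sum-drop-prefix m (n ∸ m) (λ i → P m i * g (n ∸ i))
           (λ i i<m → trans (cong (_* g (n ∸ i)) (high m i i<m)) (*-zeroˡ (g (n ∸ i)))))) ⟩
    f m * sumTo (m +ℕ (n ∸ m)) (λ i → P m i * g (n ∸ i))
      ≡⟨ cong (λ r → f m * sumTo r (λ i → P m i * g (n ∸ i))) (ℕP.m+[n∸m]≡n m≤n) ⟩
    f m * (P m ⊛ g) n ∎

conv-assoc : ∀ a b c n → ((a ⊛ b) ⊛ c) n ≡ (a ⊛ (b ⊛ c)) n
conv-assoc a b c n = begin
  sumTo n (λ s → sumTo s (λ i → a i * b (s ∸ i)) * c (n ∸ s))
    ≡⟨ sum-ext n (λ s → sum-*r s (c (n ∸ s)) (λ i → a i * b (s ∸ i))) ⟩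
  sumTo n (λ s → sumTo s (λ i → a i * b (s ∸ i) * c (n ∸ s)))
    ≡⟨ sum-triangle n (λ i s → a i * b (s ∸ i) * c (n ∸ s)) ⟩
  sumTo n (λ i → sumTo (n ∸ i) (λ j → a i * b (i +ℕ j ∸ i) * c (n ∸ (i +ℕ j))))
    ≡⟨ sum-ext n column ⟩
  (a ⊛ (b ⊛ c)) n ∎
  where
  column : ∀ i → sumTo (n ∸ i) (λ j → a i * b (i +ℕ j ∸ i) * c (n ∸ (i +ℕ j)))
                 ≡ a i * (b ⊛ c) (n ∸ i)
  column i = begin
    sumTo (n ∸ i) (λ j → a i * b (i +ℕ j ∸ i) * c (n ∸ (i +ℕ j)))
      ≡⟨ sum-ext (n ∸ i) (λ j → trans
           (cong₂ (λ p q → a i * b p * c q) (ℕP.m+n∸m≡n i j) (sym (ℕP.∸-+-assoc n i j)))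
           (*-assoc (a i) (b j) (c (n ∸ i ∸ j)))) ⟩
    sumTo (n ∸ i) (λ j → a i * (b j * c (n ∸ i ∸ j)))
      ≡⟨ sym (sum-*l (n ∸ i) (a i) _) ⟩
    a i * (b ⊛ c) (n ∸ i) ∎

pow-highOrder : ∀ g → g 0 ≡ 0ℚ → HighOrder (g ^S_)
pow-highOrder g g0≡0 (suc m) zero _ = trans (cong (_* (g ^S m) 0) g0≡0) (*-zeroˡ ((g ^S m) 0))
pow-highOrder g g0≡0 (suc m) (suc i) (s≤s i<m) = sum-zero (suc i) _ term≡0
  where
  term≡0 : ∀ j → j ≤ℕ suc i → g j * (g ^S m) (suc i ∸ j) ≡ 0ℚ
  term≡0 zero _ = trans (cong (_* (g ^S m) (suc i)) g0≡0) (*-zeroˡ ((g ^S m) (suc i)))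
  term≡0 (suc j) _ = trans
    (cong (g (suc j) *_) (pow-highOrder g g0≡0 m (i ∸ j) (ℕP.≤-<-trans (ℕP.m∸n≤m i j) i<m)))
    (*-zeroʳ (g (suc j)))

∘S-sub : ∀ f f' g n → (f ∘S g) n - (f' ∘S g) n ≡ ((λ m → f m - f' m) ∘S g) n
∘S-sub f f' g n = trans (sym (sum-- n _ _))
  (sum-ext n (λ m → solve 3 (λ a b x → a :* x :- b :* x := (a :- b) :* x) refl
                      (f m) (f' m) ((g ^S m) n)))

timesT-∘S : ∀ g → g 0 ≡ 0ℚ → ∀ f n → (timesT f ∘S g) n ≡ (g ⊛ (f ∘S g)) n
timesT-∘S g g0≡0 f n = begin
  (timesT f ∘S g) n
    ≡⟨ lhs n ⟩
  sumTo n (λ m → f m * (g ^S suc m) n)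
    ≡⟨ sym (sum-ext n (λ m → cong (f m *_) (conv-comm (g ^S m) g n))) ⟩
  lincomb f (λ m → (g ^S m) ⊛ g) n
    ≡⟨ sym (lincomb-conv (pow-highOrder g g0≡0) f g n) ⟩
  ((f ∘S g) ⊛ g) n
    ≡⟨ conv-comm (f ∘S g) g n ⟩
  (g ⊛ (f ∘S g)) n ∎
  where
  high = pow-highOrder g g0≡0
  -- reindex m ↦ m+1; the new top term involves (g^(n+1))_n = 0
  lhs : ∀ n → (timesT f ∘S g) n ≡ sumTo n (λ m → f m * (g ^S suc m) n)
  lhs zero = trans (*-zeroˡ (oneS 0)) (sym (trans (cong (f 0 *_) (high 1 0 (s≤s z≤n))) (*-zeroʳ (f 0))))
  lhs (suc n) = begin
    (timesT f ∘S g) (suc n)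
      ≡⟨ sum-shift n (λ m → timesT f m * (g ^S m) (suc n)) ⟩
    0ℚ * 0ℚ + sumTo n (λ m → f m * (g ^S suc m) (suc n))
      ≡⟨ +-identityˡ _ ⟩
    sumTo n (λ m → f m * (g ^S suc m) (suc n))
      ≡⟨ sym (sum-drop-last n _ (trans (cong (f (suc n) *_) (high (suc (suc n)) (suc n) ℕP.≤-refl))
                                      (*-zeroʳ (f (suc n))))) ⟩
    sumTo (suc n) (λ m → f m * (g ^S suc m) (suc n)) ∎

deriv : FPS → FPS
deriv f n = ℕ→ℚ (suc n) * f (suc n)

timesT-deriv : ∀ f n → timesT (deriv f) n ≡ ℕ→ℚ n * f n
timesT-deriv f zero = sym (*-zeroˡ (f 0))
timesT-deriv f (suc n) = refl

deriv-conv : ∀ f g n → deriv (f ⊛ g) n ≡ (deriv f ⊛ g) n + (f ⊛ deriv g) n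
deriv-conv f g n = begin
  ℕ→ℚ (suc n) * sumTo (suc n) (λ i → f i * g (suc n ∸ i))
    ≡⟨ sum-*l (suc n) (ℕ→ℚ (suc n)) _ ⟩
  sumTo (suc n) (λ i → ℕ→ℚ (suc n) * (f i * g (suc n ∸ i)))
    ≡⟨ sum-cong (suc n) split ⟩
  sumTo (suc n) (λ i → (ℕ→ℚ i * f i) * g (suc n ∸ i) + f i * (ℕ→ℚ (suc n ∸ i) * g (suc n ∸ i)))
    ≡⟨ sum-+ (suc n) _ _ ⟩
  sumTo (suc n) (λ i → (ℕ→ℚ i * f i) * g (suc n ∸ i))
    + sumTo (suc n) (λ i → f i * (ℕ→ℚ (suc n ∸ i) * g (suc n ∸ i)))
    ≡⟨ cong₂ _+_ derivative-on-f derivative-on-g ⟩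
  (deriv f ⊛ g) n + (f ⊛ deriv g) n ∎
  where
  -- n+1 = i + (n+1-i)
  split : ∀ i → i ≤ℕ suc n → ℕ→ℚ (suc n) * (f i * g (suc n ∸ i))
        ≡ (ℕ→ℚ i * f i) * g (suc n ∸ i) + f i * (ℕ→ℚ (suc n ∸ i) * g (suc n ∸ i))
  split i i≤n = begin
    ℕ→ℚ (suc n) * (f i * g (suc n ∸ i))
      ≡⟨ cong (λ s → ℕ→ℚ s * (f i * g (suc n ∸ i))) (sym (ℕP.m+[n∸m]≡n i≤n)) ⟩
    ℕ→ℚ (i +ℕ (suc n ∸ i)) * (f i * g (suc n ∸ i))
      ≡⟨ cong (_* (f i * g (suc n ∸ i))) (ℕ→ℚ-+ i (suc n ∸ i)) ⟩
    (ℕ→ℚ i + ℕ→ℚ (suc n ∸ i)) * (f i * g (suc n ∸ i))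
      ≡⟨ solve 4 (λ a b x y → (a :+ b) :* (x :* y) := (a :* x) :* y :+ x :* (b :* y)) refl
           (ℕ→ℚ i) (ℕ→ℚ (suc n ∸ i)) (f i) (g (suc n ∸ i)) ⟩
    (ℕ→ℚ i * f i) * g (suc n ∸ i) + f i * (ℕ→ℚ (suc n ∸ i) * g (suc n ∸ i)) ∎
  -- the i = 0 term has weight 0
  derivative-on-f : sumTo (suc n) (λ i → (ℕ→ℚ i * f i) * g (suc n ∸ i)) ≡ (deriv f ⊛ g) n
  derivative-on-f = begin
    sumTo (suc n) (λ i → (ℕ→ℚ i * f i) * g (suc n ∸ i))
      ≡⟨ sum-shift n _ ⟩
    (0ℚ * f 0) * g (suc n) + (deriv f ⊛ g) n
      ≡⟨ cong (λ x → x * g (suc n) + (deriv f ⊛ g) n) (*-zeroˡ (f 0)) ⟩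
    0ℚ * g (suc n) + (deriv f ⊛ g) n
      ≡⟨ trans (cong (_+ (deriv f ⊛ g) n) (*-zeroˡ (g (suc n)))) (+-identityˡ _) ⟩
    (deriv f ⊛ g) n ∎
  -- the i = n+1 term has weight 0
  derivative-on-g : sumTo (suc n) (λ i → f i * (ℕ→ℚ (suc n ∸ i) * g (suc n ∸ i))) ≡ (f ⊛ deriv g) n
  derivative-on-g = begin
    sumTo (suc n) (λ i → f i * (ℕ→ℚ (suc n ∸ i) * g (suc n ∸ i)))
      ≡⟨ sum-drop-last n _ (trans (cong (λ r → f (suc n) * (ℕ→ℚ r * g r)) (ℕP.n∸n≡0 n))
           (trans (cong (f (suc n) *_) (*-zeroˡ (g 0))) (*-zeroʳ (f (suc n))))) ⟩
    sumTo n (λ i → f i * (ℕ→ℚ (suc n ∸ i) * g (suc n ∸ i)))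
      ≡⟨ sum-cong n (λ i i≤n → cong (λ r → f i * (ℕ→ℚ r * g r)) (ℕP.+-∸-assoc 1 i≤n)) ⟩
    (f ⊛ deriv g) n ∎

deriv-pow : ∀ g m n → deriv (g ^S suc m) n ≡ ℕ→ℚ (suc m) * (deriv g ⊛ (g ^S m)) n
deriv-pow g zero n = begin
  ℕ→ℚ (suc n) * (g ⊛ oneS) (suc n)   ≡⟨ cong (ℕ→ℚ (suc n) *_) (conv-oneS g (suc n)) ⟩
  deriv g n                          ≡⟨ sym (conv-oneS (deriv g) n) ⟩
  (deriv g ⊛ oneS) n                 ≡⟨ sym (*-identityˡ _) ⟩
  1ℚ * (deriv g ⊛ oneS) n            ∎
deriv-pow g (suc m) n = begin
  deriv (g ⊛ g^[m+1]) n
    ≡⟨ deriv-conv g g^[m+1] n ⟩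
  (deriv g ⊛ g^[m+1]) n + (g ⊛ deriv g^[m+1]) n
    ≡⟨ cong (λ x → (deriv g ⊛ g^[m+1]) n + x) (conv-congʳ g n (deriv-pow g m)) ⟩
  (deriv g ⊛ g^[m+1]) n + (g ⊛ (λ i → c * (deriv g ⊛ (g ^S m)) i)) n
    ≡⟨ cong (λ x → (deriv g ⊛ g^[m+1]) n + x) (conv-scalʳ g c (deriv g ⊛ (g ^S m)) n) ⟩
  (deriv g ⊛ g^[m+1]) n + c * (g ⊛ (deriv g ⊛ (g ^S m))) n
    ≡⟨ cong (λ x → (deriv g ⊛ g^[m+1]) n + c * x) reassociate ⟩
  (deriv g ⊛ g^[m+1]) n + c * (deriv g ⊛ g^[m+1]) n
    ≡⟨ solve 2 (λ x c → x :+ c :* x := (con 1ℚ :+ c) :* x) refl ((deriv g ⊛ g^[m+1]) n) c ⟩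
  (1ℚ + c) * (deriv g ⊛ g^[m+1]) n
    ≡⟨ cong (_* (deriv g ⊛ g^[m+1]) n) (sym (ℕ→ℚ-suc (suc m))) ⟩
  ℕ→ℚ (suc (suc m)) * (deriv g ⊛ g^[m+1]) n ∎
  where
  c = ℕ→ℚ (suc m)
  g^[m+1] = g ^S suc m
  reassociate : (g ⊛ (deriv g ⊛ (g ^S m))) n ≡ (deriv g ⊛ g^[m+1]) n
  reassociate = begin
    (g ⊛ (deriv g ⊛ (g ^S m))) n   ≡⟨ sym (conv-assoc g (deriv g) (g ^S m) n) ⟩
    ((g ⊛ deriv g) ⊛ (g ^S m)) n   ≡⟨ conv-congˡ (g ^S m) n (conv-comm g (deriv g)) ⟩
    ((deriv g ⊛ g) ⊛ (g ^S m)) n   ≡⟨ conv-assoc (deriv g) g (g ^S m) n ⟩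
    (deriv g ⊛ g^[m+1]) n          ∎

deriv-∘S : ∀ g → g 0 ≡ 0ℚ → ∀ f n → deriv (f ∘S g) n ≡ ((deriv f ∘S g) ⊛ deriv g) n
deriv-∘S g g0≡0 f n = begin
  ℕ→ℚ (suc n) * sumTo (suc n) (λ m → f m * (g ^S m) (suc n))
    ≡⟨ sum-*l (suc n) (ℕ→ℚ (suc n)) _ ⟩
  sumTo (suc n) (λ m → ℕ→ℚ (suc n) * (f m * (g ^S m) (suc n)))
    ≡⟨ sum-shift n _ ⟩
  ℕ→ℚ (suc n) * (f 0 * 0ℚ) + sumTo n (λ j → ℕ→ℚ (suc n) * (f (suc j) * (g ^S suc j) (suc n)))
    ≡⟨ cong₂ _+_ (trans (cong (ℕ→ℚ (suc n) *_) (*-zeroʳ (f 0))) (*-zeroʳ (ℕ→ℚ (suc n))))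
                 (sum-ext n term) ⟩
  0ℚ + lincomb (deriv f) (λ j → (g ^S j) ⊛ deriv g) n
    ≡⟨ +-identityˡ _ ⟩
  lincomb (deriv f) (λ j → (g ^S j) ⊛ deriv g) n
    ≡⟨ sym (lincomb-conv (pow-highOrder g g0≡0) (deriv f) (deriv g) n) ⟩
  ((deriv f ∘S g) ⊛ deriv g) n ∎
  where
  term : ∀ j → ℕ→ℚ (suc n) * (f (suc j) * (g ^S suc j) (suc n)) ≡ deriv f j * ((g ^S j) ⊛ deriv g) n
  term j = begin
    ℕ→ℚ (suc n) * (f (suc j) * (g ^S suc j) (suc n))
      ≡⟨ solve 3 (λ a b x → a :* (b :* x) := b :* (a :* x)) refl
           (ℕ→ℚ (suc n)) (f (suc j)) ((g ^S suc j) (suc n)) ⟩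
    f (suc j) * deriv (g ^S suc j) n
      ≡⟨ cong (f (suc j) *_) (deriv-pow g j n) ⟩
    f (suc j) * (ℕ→ℚ (suc j) * (deriv g ⊛ (g ^S j)) n)
      ≡⟨ solve 3 (λ a b x → b :* (a :* x) := (a :* b) :* x) refl
           (ℕ→ℚ (suc j)) (f (suc j)) ((deriv g ⊛ (g ^S j)) n) ⟩
    deriv f j * (deriv g ⊛ (g ^S j)) n
      ≡⟨ cong (deriv f j *_) (conv-comm (deriv g) (g ^S j) n) ⟩
    deriv f j * ((g ^S j) ⊛ deriv g) n ∎

-- The series log(1+t) and t/log(1+t).  The sequence sgn, read as a series,
-- is 1/(1+t).

deriv-logS : ∀ n → deriv logS n ≡ sgn n
deriv-logS n = begin
  ℕ→ℚ (suc n) * (sgn n * ((+ 1) / suc n))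
    ≡⟨ solve 3 (λ a s r → a :* (s :* r) := s :* (a :* r)) refl (ℕ→ℚ (suc n)) (sgn n) ((+ 1) / suc n) ⟩
  sgn n * (ℕ→ℚ (suc n) * ((+ 1) / suc n))
    ≡⟨ cong (sgn n *_) (ℕ→ℚ-inverse n) ⟩
  sgn n * 1ℚ
    ≡⟨ *-identityʳ (sgn n) ⟩
  sgn n ∎

telescope : ∀ (a : ℕ → ℚ) N → sumTo N (λ m → sgn m * (a m + a (suc m))) ≡ a 0 + sgn N * a (suc N)
telescope a zero = solve 2 (λ x y → con 1ℚ :* (x :+ y) := x :+ con 1ℚ :* y) refl (a 0) (a 1)
telescope a (suc N) = begin
  sumTo N (λ m → sgn m * (a m + a (suc m))) + sgn (suc N) * (a (suc N) + a (suc (suc N)))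
    ≡⟨ cong (_+ sgn (suc N) * (a (suc N) + a (suc (suc N)))) (telescope a N) ⟩
  a 0 + sgn N * a (suc N) + (- 1ℚ) * sgn N * (a (suc N) + a (suc (suc N)))
    ≡⟨ solve 4 (λ x s y z → x :+ s :* y :+ (:- con 1ℚ) :* s :* (y :+ z) := x :+ (:- con 1ℚ) :* s :* z)
         refl (a 0) (sgn N) (a (suc N)) (a (suc (suc N))) ⟩
  a 0 + sgn (suc N) * a (suc (suc N)) ∎

geometric-inverse : ∀ u → u 0 ≡ 0ℚ → ∀ n → ((sgn ∘S u) ⊛ (λ i → oneS i + u i)) n ≡ oneS n
geometric-inverse u u0≡0 n = begin
  ((sgn ∘S u) ⊛ (λ i → oneS i + u i)) n
    ≡⟨ trans (sum-ext n (λ i → *-distribˡ-+ ((sgn ∘S u) i) _ _)) (sum-+ n _ _) ⟩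
  ((sgn ∘S u) ⊛ oneS) n + ((sgn ∘S u) ⊛ u) n
    ≡⟨ cong₂ _+_ (conv-oneS (sgn ∘S u) n) (lincomb-conv high sgn u n) ⟩
  lincomb sgn (u ^S_) n + lincomb sgn (λ m → (u ^S m) ⊛ u) n
    ≡⟨ sym (sum-+ n _ _) ⟩
  sumTo n (λ m → sgn m * (u ^S m) n + sgn m * ((u ^S m) ⊛ u) n)
    ≡⟨ sum-ext n (λ m → trans (sym (*-distribˡ-+ (sgn m) _ _))
                              (cong (λ x → sgn m * ((u ^S m) n + x)) (conv-comm (u ^S m) u n))) ⟩
  sumTo n (λ m → sgn m * ((u ^S m) n + (u ^S suc m) n))
    ≡⟨ telescope (λ m → (u ^S m) n) n ⟩
  oneS n + sgn n * (u ^S suc n) n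
    ≡⟨ cong (λ x → oneS n + sgn n * x) (high (suc n) n ℕP.≤-refl) ⟩
  oneS n + sgn n * 0ℚ
    ≡⟨ trans (cong (λ x → oneS n + x) (*-zeroʳ (sgn n))) (+-identityʳ (oneS n)) ⟩
  oneS n ∎
  where high = pow-highOrder u u0≡0

logS-factor : ∀ n → logS n ≡ timesT (λ i → oneS i + logOverTMinusOne i) n
logS-factor zero = refl
logS-factor (suc zero) = refl
logS-factor (suc (suc n)) = sym (+-identityˡ (logOverTMinusOne (suc n)))

tOverLog-logS : ∀ n → (tOverLog ⊛ logS) n ≡ timesT oneS n
tOverLog-logS n = begin
  (tOverLog ⊛ logS) n
    ≡⟨ conv-congʳ tOverLog n logS-factor ⟩
  (tOverLog ⊛ timesT w) n
    ≡⟨ conv-comm tOverLog (timesT w) n ⟩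
  (timesT w ⊛ tOverLog) n
    ≡⟨ conv-timesT w tOverLog n ⟩
  timesT (w ⊛ tOverLog) n
    ≡⟨ timesT-cong (λ i → trans (conv-comm w tOverLog i) (geometric-inverse logOverTMinusOne refl i)) n ⟩
  timesT oneS n ∎
  where
  w : FPS
  w i = oneS i + logOverTMinusOne i

invPowZ-pred : ∀ k m → invPowZ m (k -ℤ + 1) ≡ ℕ→ℚ (suc m) * invPowZ m k
invPowZ-pred (+ zero) m = refl
invPowZ-pred (+ suc j) m = begin
  invPowZ m (+ j)
    ≡⟨ sym (*-identityˡ (invPowZ m (+ j))) ⟩
  1ℚ * invPowZ m (+ j)
    ≡⟨ cong (_* invPowZ m (+ j)) (sym (ℕ→ℚ-inverse m)) ⟩
  (ℕ→ℚ (suc m) * ((+ 1) / suc m)) * invPowZ m (+ j)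
    ≡⟨ *-assoc (ℕ→ℚ (suc m)) ((+ 1) / suc m) (invPowZ m (+ j)) ⟩
  ℕ→ℚ (suc m) * invPowZ m (+ suc j) ∎
invPowZ-pred -[1+ j ] m = cong (λ i → invPowZ m -[1+ suc i ]) (ℕP.+-identityʳ j)

Lif-pred : ∀ k m → Lif (k -ℤ + 1) m - Lif k m ≡ timesT (deriv (Lif k)) m
Lif-pred k m = begin
  invFact m * invPowZ m (k -ℤ + 1) - invFact m * invPowZ m k
    ≡⟨ cong (λ x → invFact m * x - invFact m * invPowZ m k)
         (trans (invPowZ-pred k m) (cong (_* invPowZ m k) (ℕ→ℚ-suc m))) ⟩
  invFact m * ((1ℚ + ℕ→ℚ m) * invPowZ m k) - invFact m * invPowZ m k
    ≡⟨ solve 3 (λ f a x → f :* ((con 1ℚ :+ a) :* x) :- f :* x := a :* (f :* x)) refl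
         (invFact m) (ℕ→ℚ m) (invPowZ m k) ⟩
  ℕ→ℚ m * Lif k m
    ≡⟨ sym (timesT-deriv (Lif k) m) ⟩
  timesT (deriv (Lif k)) m ∎

factorial-split : ∀ n l → l ≤ℕ n → ℕ→ℚ ((n ∸ l) !) * ℕ→ℚ (n C l) * ℕ→ℚ (l !) ≡ ℕ→ℚ (n !)
factorial-split n l l≤n = begin
  ℕ→ℚ ((n ∸ l) !) * ℕ→ℚ (n C l) * ℕ→ℚ (l !)
    ≡⟨ cong (_* ℕ→ℚ (l !)) (sym (ℕ→ℚ-* ((n ∸ l) !) (n C l))) ⟩
  ℕ→ℚ ((n ∸ l) ! *ℕ (n C l)) * ℕ→ℚ (l !)
    ≡⟨ sym (ℕ→ℚ-* ((n ∸ l) ! *ℕ (n C l)) (l !)) ⟩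
  ℕ→ℚ ((n ∸ l) ! *ℕ (n C l) *ℕ l !)
    ≡⟨ cong ℕ→ℚ in-ℕ ⟩
  ℕ→ℚ (n !) ∎
  where
  nz = l !* (n ∸ l) !≢0
  in-ℕ : (n ∸ l) ! *ℕ (n C l) *ℕ l ! ≡ n !
  in-ℕ = begin
    (n ∸ l) ! *ℕ (n C l) *ℕ l !
      ≡⟨ cong (λ x → (n ∸ l) ! *ℕ x *ℕ l !) (nCk≡n!/k![n-k]! l≤n) ⟩
    (n ∸ l) ! *ℕ ((n ! ℕ./ (l ! *ℕ (n ∸ l) !)) {{nz}}) *ℕ l !
      ≡⟨ ℕP.*-comm ((n ∸ l) ! *ℕ _) (l !) ⟩
    l ! *ℕ ((n ∸ l) ! *ℕ ((n ! ℕ./ (l ! *ℕ (n ∸ l) !)) {{nz}}))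
      ≡⟨ sym (ℕP.*-assoc (l !) ((n ∸ l) !) _) ⟩
    (l ! *ℕ (n ∸ l) !) *ℕ ((n ! ℕ./ (l ! *ℕ (n ∸ l) !)) {{nz}})
      ≡⟨ m*[n/m]≡n {{nz}} (k![n∸k]!∣n! l≤n) ⟩
    n ! ∎

-- T_l^(1,k-1) - T_l^(1,k) = l! [t^l] E, since t/L · (Lif_{k-1}(L) - Lif_k(L)) = t/L · L · Lif_k'(L).
T-difference : ∀ k l → T l 1 (k -ℤ + 1) - T l 1 k ≡ ℕ→ℚ (l !) * timesT (deriv (Lif k) ∘S logS) l
T-difference k l = begin
  F * (Q ⊛ G₁) l - F * (Q ⊛ G) l
    ≡⟨ solve 3 (λ f x y → f :* x :- f :* y := f :* (x :- y)) refl F ((Q ⊛ G₁) l) ((Q ⊛ G) l) ⟩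
  F * ((Q ⊛ G₁) l - (Q ⊛ G) l)
    ≡⟨ cong (F *_) (conv-subʳ Q G₁ G l) ⟩
  F * (Q ⊛ (λ i → G₁ i - G i)) l
    ≡⟨ cong (F *_) (conv-congʳ Q l (λ i → trans (∘S-sub (Lif (k -ℤ + 1)) (Lif k) logS i)
                                      (sum-ext i (λ m → cong (_* (logS ^S m) i) (Lif-pred k m))))) ⟩
  F * (Q ⊛ (timesT c' ∘S logS)) l
    ≡⟨ cong (F *_) (conv-congʳ Q l (timesT-∘S logS refl c')) ⟩
  F * (Q ⊛ (logS ⊛ (c' ∘S logS))) l
    ≡⟨ cong (F *_) (sym (conv-assoc Q logS (c' ∘S logS) l)) ⟩
  F * ((Q ⊛ logS) ⊛ (c' ∘S logS)) l
    ≡⟨ cong (F *_) (conv-congˡ (c' ∘S logS) l (λ i → trans (conv-congˡ logS i (conv-oneS tOverLog))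
                                                            (tOverLog-logS i))) ⟩
  F * (timesT oneS ⊛ (c' ∘S logS)) l
    ≡⟨ cong (F *_) (timesT-one-conv (c' ∘S logS) l) ⟩
  F * timesT (c' ∘S logS) l ∎
  where
  F = ℕ→ℚ (l !)
  Q = tOverLog ^S 1
  G₁ = Lif (k -ℤ + 1) ∘S logS
  G = Lif k ∘S logS
  c' = deriv (Lif k)

-- Σ_{l≤n} (-1)^(n-l) [t^l] E = [t^n] E/(1+t) = [t^n] t G' = n [t^n] G
alternating-sum : ∀ k n → (timesT (deriv (Lif k) ∘S logS) ⊛ sgn) n ≡ ℕ→ℚ n * (Lif k ∘S logS) n
alternating-sum k n = begin
  (timesT (c' ∘S logS) ⊛ sgn) n
    ≡⟨ conv-timesT (c' ∘S logS) sgn n ⟩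
  timesT ((c' ∘S logS) ⊛ sgn) n
    ≡⟨ timesT-cong (λ i → conv-congʳ (c' ∘S logS) i (λ j → sym (deriv-logS j))) n ⟩
  timesT ((c' ∘S logS) ⊛ deriv logS) n
    ≡⟨ timesT-cong (λ i → sym (deriv-∘S logS refl (Lif k) i)) n ⟩
  timesT (deriv (Lif k ∘S logS)) n
    ≡⟨ timesT-deriv (Lif k ∘S logS) n ⟩
  ℕ→ℚ n * (Lif k ∘S logS) n ∎
  where c' = deriv (Lif k)

lemma6 : (k : ℤ) (n : ℕ) .{{_ : NonZero n}} →
    polyC n k ≡ ((+ 1) / n) * sumTo n (λ l →
      sgn (n ∸ l) * ℕ→ℚ ((n ∸ l) !) * ℕ→ℚ (n C l) * (T l 1 (k -ℤ + 1) - T l 1 k))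
lemma6 k n@(suc m) = sym (begin
  r * sumTo n (λ l → sgn (n ∸ l) * ℕ→ℚ ((n ∸ l) !) * ℕ→ℚ (n C l) * (T l 1 (k -ℤ + 1) - T l 1 k))
    ≡⟨ cong (r *_) (sum-cong n summand) ⟩
  r * sumTo n (λ l → F * (E l * sgn (n ∸ l)))
    ≡⟨ cong (r *_) (sym (sum-*l n F _)) ⟩
  r * (F * (E ⊛ sgn) n)
    ≡⟨ cong (λ x → r * (F * x)) (alternating-sum k n) ⟩
  r * (F * (ℕ→ℚ n * G n))
    ≡⟨ solve 4 (λ r f a g → r :* (f :* (a :* g)) := (a :* r) :* (f :* g)) refl r F (ℕ→ℚ n) (G n) ⟩
  (ℕ→ℚ n * r) * (F * G n)
    ≡⟨ trans (cong (_* (F * G n)) (ℕ→ℚ-inverse m)) (*-identityˡ (F * G n)) ⟩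
  polyC n k ∎)
  where
  r = (+ 1) / n
  F = ℕ→ℚ (n !)
  G = Lif k ∘S logS
  E = timesT (deriv (Lif k) ∘S logS)
  summand : ∀ l → l ≤ℕ n → sgn (n ∸ l) * ℕ→ℚ ((n ∸ l) !) * ℕ→ℚ (n C l) * (T l 1 (k -ℤ + 1) - T l 1 k)
          ≡ F * (E l * sgn (n ∸ l))
  summand l l≤n = begin
    sgn (n ∸ l) * ℕ→ℚ ((n ∸ l) !) * ℕ→ℚ (n C l) * (T l 1 (k -ℤ + 1) - T l 1 k)
      ≡⟨ cong (sgn (n ∸ l) * ℕ→ℚ ((n ∸ l) !) * ℕ→ℚ (n C l) *_) (T-difference k l) ⟩
    sgn (n ∸ l) * ℕ→ℚ ((n ∸ l) !) * ℕ→ℚ (n C l) * (ℕ→ℚ (l !) * E l)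
      ≡⟨ solve 5 (λ s a b f e → s :* a :* b :* (f :* e) := (a :* b :* f) :* (e :* s)) refl
           (sgn (n ∸ l)) (ℕ→ℚ ((n ∸ l) !)) (ℕ→ℚ (n C l)) (ℕ→ℚ (l !)) (E l) ⟩
    (ℕ→ℚ ((n ∸ l) !) * ℕ→ℚ (n C l) * ℕ→ℚ (l !)) * (E l * sgn (n ∸ l))
      ≡⟨ cong (_* (E l * sgn (n ∸ l))) (factorial-split n l l≤n) ⟩
    F * (E l * sgn (n ∸ l)) ∎
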